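{- Let $-\ltimes U:\mathcal W\to\mathcal V$ be a non-spooky multiplier for $U\in\mathcal V$. Then $\partial U$ is the largest proper subpresheaf of $\mathbf yU$.
   Context: $\mathcal W$ has a terminal object $\top$. A multiplier for $U$ is a functor $-\ltimes U:\mathcal W\to\mathcal V$ with an isomorphism $\top\ltimes U\cong U$; $\pi_2:W\ltimes U\to U$ is $(!_W\ltimes U)$ followed by it; it is non-spooky if every such $\pi_2$ is split epi. A morphism $\varphi:V\to U$ is dimensionally split if there exist $W\in\mathcal W$ and $\chi:W\ltimes U\to V$ with $\varphi\circ\chi=\pi_2$. $\mathbf yU$ is the representable presheaf on $\mathcal V$, and $\partial U$ is its subpresheaf with $\partial U(V)=\{\varphi:V\to U\mid\varphi$ is not dimensionally split$\}$. -}

module Defs where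

open import Level using (Level; _⊔_; suc)
open import Agda.Primitive using (Setω)
open import Data.Product using (Σ; Σ-syntax; _,_)
open import Relation.Nullary using (¬_)
open import Relation.Binary.PropositionalEquality using (_≡_)

record Category (o ℓ : Level) : Set (suc (o ⊔ ℓ)) where
  infixr 9 _∘_
  field
    Obj : Set o
    Hom : Obj → Obj → Set ℓ
    id  : ∀ {A} → Hom A A
    _∘_ : ∀ {A B C} → Hom B C → Hom A B → Hom A C
    identityˡ : ∀ {A B} {f : Hom A B} → id ∘ f ≡ f
    identityʳ : ∀ {A B} {f : Hom A B} → f ∘ id ≡ f
    assoc : ∀ {A B C D} {f : Hom A B} {g : Hom B C} {h : Hom C D} →
            (h ∘ g) ∘ f ≡ h ∘ (g ∘ f)

record Functor {o ℓ o' ℓ'} (C : Category o ℓ) (D : Category o' ℓ')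
       : Set (o ⊔ ℓ ⊔ o' ⊔ ℓ') where
  private
    module C = Category C
    module D = Category D
  field
    F₀ : C.Obj → D.Obj
    F₁ : ∀ {A B} → C.Hom A B → D.Hom (F₀ A) (F₀ B)
    identity : ∀ {A} → F₁ (C.id {A}) ≡ D.id
    homomorphism : ∀ {A B C'} {f : C.Hom A B} {g : C.Hom B C'} →
                   F₁ (g C.∘ f) ≡ F₁ g D.∘ F₁ f

record Terminal {o ℓ} (C : Category o ℓ) : Set (o ⊔ ℓ) where
  open Category C
  field
    ⊤ : Obj
    ! : ∀ {A} → Hom A ⊤
    !-unique : ∀ {A} (f : Hom A ⊤) → ! ≡ f

record Multiplier {o ℓ o' ℓ'} (W : Category o ℓ) (V : Category o' ℓ')
       (T : Terminal W) (U : Category.Obj V) : Set (o ⊔ ℓ ⊔ o' ⊔ ℓ') where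
  private
    module V = Category V
  open Terminal T
  field
    mult : Functor W V
  open Functor mult public renaming (F₀ to _⋉U; F₁ to _⋉U₁)
  field
    iso     : V.Hom (⊤ ⋉U) U
    iso⁻¹   : V.Hom U (⊤ ⋉U)
    iso-isoˡ : iso⁻¹ V.∘ iso ≡ V.id
    iso-isoʳ : iso V.∘ iso⁻¹ ≡ V.id

module _ {o ℓ o' ℓ'} {W : Category o ℓ} {V : Category o' ℓ'}
         {T : Terminal W} {U : Category.Obj V} (M : Multiplier W V T U) where
  private
    module W = Category W
    module V = Category V
  open Terminal T
  open Multiplier M

  π₂ : (X : W.Obj) → V.Hom (X ⋉U) U
  π₂ X = iso V.∘ (! {X} ⋉U₁)

  NonSpooky : Set (o ⊔ ℓ')
  NonSpooky = ∀ (X : W.Obj) → Σ[ σ ∈ V.Hom U (X ⋉U) ] (π₂ X V.∘ σ ≡ V.id)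

  DimSplit : ∀ {Y} → V.Hom Y U → Set (o ⊔ ℓ')
  DimSplit {Y} φ = Σ[ X ∈ W.Obj ] Σ[ χ ∈ V.Hom (X ⋉U) Y ] (φ V.∘ χ ≡ π₂ X)

-- A subpresheaf of the representable presheaf y U: a family of subsets of
-- Hom(Y, U), closed under precomposition (the presheaf action of y U).
record Subpresheaf {o ℓ} (C : Category o ℓ) (U : Category.Obj C) (p : Level)
       : Set (o ⊔ ℓ ⊔ suc p) where
  open Category C
  field
    S : ∀ {Y} → Hom Y U → Set p
    S-closed : ∀ {Y Z} (φ : Hom Y U) (ψ : Hom Z Y) → S φ → S (φ ∘ ψ)

module _ {o ℓ} {C : Category o ℓ} {U : Category.Obj C} where
  open Category C

  _⊆_ : ∀ {p q} → Subpresheaf C U p → Subpresheaf C U q → Set (o ⊔ ℓ ⊔ p ⊔ q)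
  A ⊆ B = ∀ {Y} (φ : Hom Y U) → Subpresheaf.S A φ → Subpresheaf.S B φ

  Proper : ∀ {p} → Subpresheaf C U p → Set (o ⊔ ℓ ⊔ p)
  Proper A = ¬ (∀ {Y} (φ : Hom Y U) → Subpresheaf.S A φ)

  record IsLargestProper {p} (A : Subpresheaf C U p) : Setω where
    field
      proper  : Proper A
      largest : ∀ {q} (B : Subpresheaf C U q) → Proper B → B ⊆ A

module _ {o ℓ o' ℓ'} {W : Category o ℓ} {V : Category o' ℓ'}
         {T : Terminal W} {U : Category.Obj V} (M : Multiplier W V T U) where
  open Category V

  ∂-closed : ∀ {Y Z} (φ : Hom Y U) (ψ : Hom Z Y) →
             ¬ DimSplit M φ → ¬ DimSplit M (φ ∘ ψ)
  ∂-closed φ ψ nd (X , χ , eq) = nd (X , ψ ∘ χ , Eq.trans (Eq.sym assoc) eq)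
    where import Relation.Binary.PropositionalEquality as Eq

  ∂ : Subpresheaf V U (o ⊔ ℓ')
  ∂ = record { S = λ φ → ¬ DimSplit M φ ; S-closed = ∂-closed }

{-# OPTIONS --safe #-}
-- When the multiplier is non-spooky, a dimensionally split φ (φ ∘ χ = π₂) is split epi,
-- with section χ ∘ σ for a section σ of π₂.  A subpresheaf of y U containing a split epi φ
-- with section s contains every ψ = φ ∘ (s ∘ ψ), so a proper one contains no dimensionally
-- split morphism.  And ∂U is proper because id is dimensionally split via ⊤ ⋉ U ≅ U.
module Submission where

open import Defs
open import Data.Product using (Σ-syntax; _,_)
open import Relation.Binary.PropositionalEquality using (_≡_; sym; cong; subst; module ≡-Reasoning)

module _ {o ℓ} (C : Category o ℓ) {U : Category.Obj C} where
  open Category C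

  SplitEpi : ∀ {Y} → Hom Y U → Set ℓ
  SplitEpi φ = Σ[ s ∈ Hom U _ ] (φ ∘ s ≡ id)

  subpresheaf-total-if-splitEpi : ∀ {p} (B : Subpresheaf C U p) {Y} (φ : Hom Y U) →
                                  SplitEpi φ → Subpresheaf.S B φ →
                                  ∀ {Z} (ψ : Hom Z U) → Subpresheaf.S B ψ
  subpresheaf-total-if-splitEpi B φ (s , φs≡id) Bφ ψ =
    subst S φ∘s∘ψ≡ψ (S-closed φ (s ∘ ψ) Bφ)
    where
      open Subpresheaf B
      open ≡-Reasoning
      φ∘s∘ψ≡ψ : φ ∘ (s ∘ ψ) ≡ ψ
      φ∘s∘ψ≡ψ = begin
        φ ∘ (s ∘ ψ) ≡⟨ sym assoc ⟩
        (φ ∘ s) ∘ ψ ≡⟨ cong (_∘ ψ) φs≡id ⟩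
        id ∘ ψ      ≡⟨ identityˡ ⟩
        ψ           ∎

module _ {o ℓ o' ℓ'} {W : Category o ℓ} {V : Category o' ℓ'}
         {T : Terminal W} {U : Category.Obj V} (M : Multiplier W V T U) where
  open Category V
  private module W = Category W
  open Terminal T
  open Multiplier M

  π₂-⊤ : π₂ M ⊤ ≡ iso
  π₂-⊤ = begin
    iso ∘ (! ⋉U₁)    ≡⟨ cong (λ f → iso ∘ (f ⋉U₁)) (!-unique W.id) ⟩
    iso ∘ (W.id ⋉U₁) ≡⟨ cong (iso ∘_) identity ⟩
    iso ∘ id         ≡⟨ identityʳ ⟩
    iso              ∎
    where open ≡-Reasoning

  id-dimSplit : DimSplit M (id {U})
  id-dimSplit = ⊤ , iso , (begin
    id ∘ iso ≡⟨ identityˡ ⟩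
    iso      ≡⟨ sym π₂-⊤ ⟩
    π₂ M ⊤   ∎)
    where open ≡-Reasoning

  dimSplit-splitEpi : NonSpooky M → ∀ {Y} (φ : Hom Y U) → DimSplit M φ → SplitEpi V φ
  dimSplit-splitEpi nonSpooky φ (X , χ , φχ≡π₂) with nonSpooky X
  ... | σ , π₂σ≡id = χ ∘ σ , (begin
    φ ∘ (χ ∘ σ) ≡⟨ sym assoc ⟩
    (φ ∘ χ) ∘ σ ≡⟨ cong (_∘ σ) φχ≡π₂ ⟩
    π₂ M X ∘ σ  ≡⟨ π₂σ≡id ⟩
    id          ∎)
    where open ≡-Reasoning

mainTheorem8 : ∀ {o ℓ o' ℓ'} {W : Category o ℓ} {V : Category o' ℓ'}
                 {T : Terminal W} {U : Category.Obj V}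
                 (M : Multiplier W V T U) →
                 NonSpooky M →
                 IsLargestProper (∂ M)
mainTheorem8 M nonSpooky = record
  { proper  = λ all-∂ → all-∂ _ (id-dimSplit M)
  ; largest = λ B B-proper φ Bφ φ-dimSplit →
      let φ-splitEpi = dimSplit-splitEpi M nonSpooky φ φ-dimSplit
      in B-proper (subpresheaf-total-if-splitEpi _ B φ φ-splitEpi Bφ)
  }
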